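{- For every integer $k\ge0$ and every integer $n\ge1$, $p_k(m_1,\ldots,m_n)$ and $q_k(m_1,\ldots,m_n)$ are symmetric polynomials in $m_1,\ldots,m_n$, and they satisfy $p_k(m_1,\ldots,m_n,0)=p_k(m_1,\ldots,m_n)$ and $q_k(m_1,\ldots,m_n,0)=q_k(m_1,\ldots,m_n)$.
   Context: For $k\ge0$: $p_k(m)=\frac{1}{(k!)^2}\prod_{i=1}^k(m^2-i^2)$ and $q_k(m)=\frac{1}{(k!)^2}\prod_{i=0}^{k-1}(m^2-i^2)$ (empty product $=1$). Multivariate: $p_k(m_1,\ldots,m_n)=\sum_{k_1+\cdots+k_n=k,\,k_i\ge0}p_{k_1}(m_1)q_{k_2}(m_2)\cdots q_{k_n}(m_n)$ and $q_k(m_1,\ldots,m_n)=\sum_{k_1+\cdots+k_n=k,\,k_i\ge0}q_{k_1}(m_1)q_{k_2}(m_2)\cdots q_{k_n}(m_n)$. -}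

module Defs where

open import Data.Nat as ℕ using (ℕ; zero; suc; _!)
open import Data.Nat.Properties using (_!*_!≢0)
open import Data.Integer using (+_)
open import Data.Rational using (ℚ; _*_; _-_; _+_; _/_; 0ℚ; 1ℚ)
open import Data.List using (List; []; _∷_; [_]; map; foldr; upTo; applyUpTo; concatMap)
open import Data.Vec using (Vec; []; _∷_)

ι : ℕ → ℚ
ι i = + i / 1

sumℚ : List ℚ → ℚ
sumℚ = foldr _+_ 0ℚ

prodℚ : List ℚ → ℚ
prodℚ = foldr _*_ 1ℚ

invFact² : ℕ → ℚ
invFact² k = (+ 1 / (k ! ℕ.* k !)) {{k !*  k !≢0}}

p₁ : ℕ → ℚ → ℚ
p₁ k m = invFact² k * prodℚ (applyUpTo (λ j → m * m - ι (suc j) * ι (suc j)) k)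

q₁ : ℕ → ℚ → ℚ
q₁ k m = invFact² k * prodℚ (map (λ i → m * m - ι i * ι i) (upTo k))

compositions : ℕ → (n : ℕ) → List (Vec ℕ n)
compositions zero    zero    = [ [] ]
compositions (suc _) zero    = []
compositions k       (suc n) =
  concatMap (λ j → map (j ∷_) (compositions (k ℕ.∸ j) n)) (upTo (suc k))

qProd : ∀ {n} → Vec ℕ n → Vec ℚ n → ℚ
qProd []       []       = 1ℚ
qProd (k ∷ ks) (m ∷ ms) = q₁ k m * qProd ks ms

pₖ : ∀ {n} → ℕ → Vec ℚ (suc n) → ℚ
pₖ {n} k (m ∷ ms) = sumℚ (map term (compositions k (suc n)))
  where
  term : Vec ℕ (suc n) → ℚ
  term (k₁ ∷ ks) = p₁ k₁ m * qProd ks ms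

qₖ : ∀ {n} → ℕ → Vec ℚ (suc n) → ℚ
qₖ {n} k ms = sumℚ (map (λ ks → qProd ks ms) (compositions k (suc n)))

-- Think of power series in x with rational coefficients. Splitting a composition
-- k₁ + ⋯ + kₙ = k by its first part shows that q_k(m₁,…,mₙ) is the coefficient of
-- x^k in the Cauchy product Q_{m₁} ⋯ Q_{mₙ}, where Q_m = Σ_k q_k(m) x^k; likewise
-- p_k(m₁,…,mₙ) is the coefficient of x^k in P_{m₁} Q_{m₂} ⋯ Q_{mₙ}. The Cauchy product
-- is commutative, so q_k is symmetric, and Q_0 = 1, so appending 0 changes nothing.
-- From q_{j+1}(m) = p_{j+1}(m) + p_j(m), i.e. Q_m = (1 + x) P_m, one gets
-- p_{k+1} + p_k = q_{k+1} in any number of variables, so the p_k are determined by the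
-- q_k, and symmetry transfers.
module Submission where

open import Defs
open import Data.Nat as ℕ using (ℕ; zero; suc; _∸_; _≤_; _<_; z≤n; s≤s; _!)
import Data.Nat.Properties as ℕ
open import Data.Nat.Properties using (_!*_!≢0)
open import Data.Nat.Tactic.RingSolver using (solve-∀)
import Data.Integer as ℤ
import Data.Integer.Properties as ℤ
open import Data.Rational using (ℚ; 0ℚ; 1ℚ; _+_; _*_; _-_; _/_; toℚᵘ)
open import Data.Rational.Properties
open import Data.Rational.Solver using (module +-*-Solver)
import Data.Rational.Unnormalised as ℚᵘ
import Data.Rational.Unnormalised.Properties as ℚᵘ
open import Data.List using (List; []; _∷_; map; applyUpTo; concatMap; _++_)
open import Data.List.Properties using (map-++; map-∘; map-cong; map-applyUpTo)
open import Data.Vec using (Vec; []; _∷_; lookup; tabulate; _∷ʳ_)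
open import Data.Vec.Properties using (lookup∘tabulate)
open import Data.Fin.Permutation using (Permutation′; _⟨$⟩ʳ_)
open import Data.Product using (_×_; _,_)
open import Algebra.Bundles using (CommutativeMonoid)
open import Algebra.Properties.CommutativeSemigroup (CommutativeMonoid.commutativeSemigroup +-0-commutativeMonoid)
  using (interchange)
open import Algebra.Properties.Group +-0-group using (∙-cancelʳ)
open import Relation.Binary.Bundles using (Setoid)
open import Relation.Binary.PropositionalEquality
open import Function using (_∘_; id)

sumUpTo : ℕ → (ℕ → ℚ) → ℚ
sumUpTo n f = sumℚ (applyUpTo f n)

sumUpTo-cong-< : ∀ n {f g : ℕ → ℚ} → (∀ j → j < n → f j ≡ g j) → sumUpTo n f ≡ sumUpTo n g
sumUpTo-cong-< zero    eq = refl
sumUpTo-cong-< (suc n) eq =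
  cong₂ _+_ (eq 0 (s≤s z≤n)) (sumUpTo-cong-< n (λ j j<n → eq (suc j) (s≤s j<n)))

sumUpTo-cong : ∀ n {f g : ℕ → ℚ} → f ≗ g → sumUpTo n f ≡ sumUpTo n g
sumUpTo-cong n eq = sumUpTo-cong-< n (λ j _ → eq j)

sumUpTo-0 : ∀ n → sumUpTo n (λ _ → 0ℚ) ≡ 0ℚ
sumUpTo-0 zero    = refl
sumUpTo-0 (suc n) = trans (cong (0ℚ +_) (sumUpTo-0 n)) (+-identityʳ 0ℚ)

sumUpTo-+ : ∀ n (f g : ℕ → ℚ) → sumUpTo n (λ j → f j + g j) ≡ sumUpTo n f + sumUpTo n g
sumUpTo-+ zero    f g = sym (+-identityʳ 0ℚ)
sumUpTo-+ (suc n) f g =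
  trans (cong (f 0 + g 0 +_) (sumUpTo-+ n (f ∘ suc) (g ∘ suc))) (interchange (f 0) (g 0) _ _)

*-distribˡ-sumUpTo : ∀ n c (f : ℕ → ℚ) → c * sumUpTo n f ≡ sumUpTo n (λ j → c * f j)
*-distribˡ-sumUpTo zero    c f = *-zeroʳ c
*-distribˡ-sumUpTo (suc n) c f =
  trans (*-distribˡ-+ c (f 0) _) (cong (c * f 0 +_) (*-distribˡ-sumUpTo n c (f ∘ suc)))

*-distribʳ-sumUpTo : ∀ n c (f : ℕ → ℚ) → sumUpTo n f * c ≡ sumUpTo n (λ j → f j * c)
*-distribʳ-sumUpTo zero    c f = *-zeroˡ c
*-distribʳ-sumUpTo (suc n) c f =
  trans (*-distribʳ-+ c (f 0) _) (cong (f 0 * c +_) (*-distribʳ-sumUpTo n c (f ∘ suc)))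

sumUpTo-suc : ∀ n (f : ℕ → ℚ) → sumUpTo (suc n) f ≡ sumUpTo n f + f n
sumUpTo-suc zero    f = trans (+-identityʳ (f 0)) (sym (+-identityˡ (f 0)))
sumUpTo-suc (suc n) f = trans (cong (f 0 +_) (sumUpTo-suc n (f ∘ suc))) (sym (+-assoc (f 0) _ _))

sumUpTo-reverse : ∀ n (f : ℕ → ℚ) → sumUpTo (suc n) f ≡ sumUpTo (suc n) (λ j → f (n ∸ j))
sumUpTo-reverse zero    f = refl
sumUpTo-reverse (suc n) f = sym (begin
  f (suc n) + sumUpTo (suc n) (λ j → f (n ∸ j)) ≡⟨ cong (f (suc n) +_) (sumUpTo-reverse n f) ⟨
  f (suc n) + sumUpTo (suc n) f                 ≡⟨ +-comm (f (suc n)) _ ⟩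
  sumUpTo (suc n) f + f (suc n)                 ≡⟨ sumUpTo-suc (suc n) f ⟨
  sumUpTo (suc (suc n)) f                       ∎)
  where open ≡-Reasoning

-- Both sides sum F j i over the triangle j + i ≤ k, indexed by j resp. by l = j + i.
sumUpTo-triangle : ∀ k (F : ℕ → ℕ → ℚ) →
  sumUpTo (suc k) (λ j → sumUpTo (suc (k ∸ j)) (F j)) ≡
  sumUpTo (suc k) (λ l → sumUpTo (suc l) (λ j → F j (l ∸ j)))
sumUpTo-triangle zero    F = refl
sumUpTo-triangle (suc k) F = begin
  (F 0 0 + A) + sumUpTo (suc k) (λ j → sumUpTo (suc (k ∸ j)) (F (suc j)))
    ≡⟨ cong ((F 0 0 + A) +_) (sumUpTo-triangle k (F ∘ suc)) ⟩
  (F 0 0 + A) + B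
    ≡⟨ +-assoc (F 0 0) A B ⟩
  F 0 0 + (A + B)
    ≡⟨ cong₂ _+_ (+-identityʳ (F 0 0)) (sumUpTo-+ (suc k) (λ l → F 0 (suc l)) (λ l → sumUpTo (suc l) (λ j → F (suc j) (l ∸ j)))) ⟨
  (F 0 0 + 0ℚ) + sumUpTo (suc k) (λ l → F 0 (suc l) + sumUpTo (suc l) (λ j → F (suc j) (l ∸ j)))
    ∎
  where
  open ≡-Reasoning
  A = sumUpTo (suc k) (λ l → F 0 (suc l))
  B = sumUpTo (suc k) (λ l → sumUpTo (suc l) (λ j → F (suc j) (l ∸ j)))

prodℚ-applyUpTo-suc : ∀ n (g : ℕ → ℚ) → prodℚ (applyUpTo g (suc n)) ≡ prodℚ (applyUpTo g n) * g n
prodℚ-applyUpTo-suc zero    g = trans (*-identityʳ (g 0)) (sym (*-identityˡ (g 0)))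
prodℚ-applyUpTo-suc (suc n) g =
  trans (cong (g 0 *_) (prodℚ-applyUpTo-suc n (g ∘ suc))) (sym (*-assoc (g 0) _ _))

sumℚ-++ : ∀ (xs ys : List ℚ) → sumℚ (xs ++ ys) ≡ sumℚ xs + sumℚ ys
sumℚ-++ []       ys = sym (+-identityˡ _)
sumℚ-++ (x ∷ xs) ys = trans (cong (x +_) (sumℚ-++ xs ys)) (sym (+-assoc x _ _))

sumℚ-concatMap : ∀ {A B : Set} (h : B → ℚ) (g : A → List B) (xs : List A) →
  sumℚ (map h (concatMap g xs)) ≡ sumℚ (map (λ x → sumℚ (map h (g x))) xs)
sumℚ-concatMap h g []       = refl
sumℚ-concatMap h g (x ∷ xs) = begin
  sumℚ (map h (g x ++ concatMap g xs))               ≡⟨ cong sumℚ (map-++ h (g x) _) ⟩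
  sumℚ (map h (g x) ++ map h (concatMap g xs))       ≡⟨ sumℚ-++ (map h (g x)) _ ⟩
  sumℚ (map h (g x)) + sumℚ (map h (concatMap g xs)) ≡⟨ cong (sumℚ (map h (g x)) +_) (sumℚ-concatMap h g xs) ⟩
  sumℚ (map h (g x)) + sumℚ (map (λ x → sumℚ (map h (g x))) xs) ∎
  where open ≡-Reasoning

*-distribˡ-sumℚ : ∀ {A : Set} c (h : A → ℚ) (xs : List A) →
  c * sumℚ (map h xs) ≡ sumℚ (map (λ x → c * h x) xs)
*-distribˡ-sumℚ c h []       = *-zeroʳ c
*-distribˡ-sumℚ c h (x ∷ xs) =
  trans (*-distribˡ-+ c (h x) _) (cong (c * h x +_) (*-distribˡ-sumℚ c h xs))

Seq : Set
Seq = ℕ → ℚ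

infixl 7 _⋆_

_⋆_ : Seq → Seq → Seq
(f ⋆ g) k = sumUpTo (suc k) (λ j → f j * g (k ∸ j))

δ : Seq
δ zero    = 1ℚ
δ (suc _) = 0ℚ

⋆-cong : ∀ {f f′ g g′ : Seq} → f ≗ f′ → g ≗ g′ → f ⋆ g ≗ f′ ⋆ g′
⋆-cong f≗f′ g≗g′ k = sumUpTo-cong (suc k) (λ j → cong₂ _*_ (f≗f′ j) (g≗g′ (k ∸ j)))

⋆-congˡ : ∀ f {g g′ : Seq} → g ≗ g′ → f ⋆ g ≗ f ⋆ g′
⋆-congˡ f = ⋆-cong {f} (λ _ → refl)

⋆-comm : ∀ f g → f ⋆ g ≗ g ⋆ f
⋆-comm f g k = trans (sumUpTo-reverse k (λ j → f j * g (k ∸ j)))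
  (sumUpTo-cong-< (suc k) λ j j≤k →
    trans (cong (λ i → f (k ∸ j) * g i) (ℕ.m∸[m∸n]≡n (ℕ.≤-pred j≤k))) (*-comm (f (k ∸ j)) (g j)))

⋆-identityˡ : ∀ f → δ ⋆ f ≗ f
⋆-identityˡ f k = begin
  1ℚ * f k + sumUpTo k (λ j → 0ℚ * f (k ∸ suc j))
    ≡⟨ cong₂ _+_ (*-identityˡ (f k)) (sumUpTo-cong k (λ j → *-zeroˡ (f (k ∸ suc j)))) ⟩
  f k + sumUpTo k (λ _ → 0ℚ) ≡⟨ cong (f k +_) (sumUpTo-0 k) ⟩
  f k + 0ℚ                   ≡⟨ +-identityʳ (f k) ⟩
  f k                        ∎
  where open ≡-Reasoning

⋆-identityʳ : ∀ f → f ⋆ δ ≗ f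
⋆-identityʳ f k = trans (⋆-comm f δ k) (⋆-identityˡ f k)

⋆-assoc : ∀ f g h → (f ⋆ g) ⋆ h ≗ f ⋆ (g ⋆ h)
⋆-assoc f g h k = begin
  sumUpTo (suc k) (λ l → sumUpTo (suc l) (λ j → f j * g (l ∸ j)) * h (k ∸ l))
    ≡⟨ sumUpTo-cong (suc k) (λ l → *-distribʳ-sumUpTo (suc l) (h (k ∸ l)) (λ j → f j * g (l ∸ j))) ⟩
  sumUpTo (suc k) (λ l → sumUpTo (suc l) (λ j → f j * g (l ∸ j) * h (k ∸ l)))
    ≡⟨ sumUpTo-cong-< (suc k) (λ l l≤k → sumUpTo-cong-< (suc l) (λ j j≤l →
         reassociate (ℕ.≤-pred l≤k) (ℕ.≤-pred j≤l))) ⟩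
  sumUpTo (suc k) (λ l → sumUpTo (suc l) (λ j → F j (l ∸ j)))
    ≡⟨ sumUpTo-triangle k F ⟨
  sumUpTo (suc k) (λ j → sumUpTo (suc (k ∸ j)) (F j))
    ≡⟨ sumUpTo-cong (suc k) (λ j → *-distribˡ-sumUpTo (suc (k ∸ j)) (f j) (λ i → g i * h (k ∸ j ∸ i))) ⟨
  (f ⋆ (g ⋆ h)) k ∎
  where
  open ≡-Reasoning
  F : ℕ → ℕ → ℚ
  F j i = f j * (g i * h (k ∸ j ∸ i))
  reassociate : ∀ {l j} → l ≤ k → j ≤ l → f j * g (l ∸ j) * h (k ∸ l) ≡ F j (l ∸ j)
  reassociate {l} {j} l≤k j≤l = trans (*-assoc (f j) (g (l ∸ j)) (h (k ∸ l)))
    (cong (λ i → f j * (g (l ∸ j) * h i))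
      (sym (trans (ℕ.∸-+-assoc k j (l ∸ j)) (cong (k ∸_) (ℕ.m+[n∸m]≡n j≤l)))))

⋆-commutativeMonoid : CommutativeMonoid _ _
⋆-commutativeMonoid = record
  { Carrier = Seq
  ; _≈_ = _≗_
  ; _∙_ = _⋆_
  ; ε = δ
  ; isCommutativeMonoid = record
    { isMonoid = record
      { isSemigroup = record
        { isMagma = record
          { isEquivalence = Setoid.isEquivalence (ℕ →-setoid ℚ)
          ; ∙-cong = ⋆-cong
          }
        ; assoc = ⋆-assoc
        }
      ; identity = ⋆-identityˡ , ⋆-identityʳ
      }
    ; comm = ⋆-comm
    }
  }

-- The hypotheses say Q = (1 + x) P as power series; then Q g = (1 + x) P g.
⋆-1+x : ∀ (P Q g : Seq) → Q 0 ≡ P 0 → (∀ j → Q (suc j) ≡ P (suc j) + P j) →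
  ∀ k → (Q ⋆ g) (suc k) ≡ (P ⋆ g) (suc k) + (P ⋆ g) k
⋆-1+x P Q g Q₀ Qₛ k = begin
  Q 0 * g (suc k) + sumUpTo (suc k) (λ j → Q (suc j) * g (k ∸ j))
    ≡⟨ cong₂ _+_ (cong (_* g (suc k)) Q₀) (sumUpTo-cong (suc k) expand) ⟩
  P 0 * g (suc k) + sumUpTo (suc k) (λ j → P (suc j) * g (k ∸ j) + P j * g (k ∸ j))
    ≡⟨ cong (P 0 * g (suc k) +_) (sumUpTo-+ (suc k) (λ j → P (suc j) * g (k ∸ j)) (λ j → P j * g (k ∸ j))) ⟩
  P 0 * g (suc k) + (sumUpTo (suc k) (λ j → P (suc j) * g (k ∸ j)) + (P ⋆ g) k)
    ≡⟨ +-assoc (P 0 * g (suc k)) _ _ ⟨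
  (P ⋆ g) (suc k) + (P ⋆ g) k ∎
  where
  open ≡-Reasoning
  expand : ∀ j → Q (suc j) * g (k ∸ j) ≡ P (suc j) * g (k ∸ j) + P j * g (k ∸ j)
  expand j = trans (cong (_* g (k ∸ j)) (Qₛ j)) (*-distribʳ-+ (g (k ∸ j)) (P (suc j)) (P j))

-- Here sum is the iterated Cauchy product.
open import Algebra.Properties.CommutativeMonoid.Sum ⋆-commutativeMonoid
  using (sum; sum-permute; sum-cong-≗)

pSeq qSeq : ℚ → Seq
pSeq m k = p₁ k m
qSeq m k = q₁ k m

qSeries : ∀ {n} → Vec ℚ n → Seq
qSeries ms = sum (λ i → qSeq (lookup ms i))

-- qₖ, but allowing no variables at all.
qSum : ∀ {n} → ℕ → Vec ℚ n → ℚ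
qSum {n} k ms = sumℚ (map (λ ks → qProd ks ms) (compositions k n))

compositions-suc : ∀ k n →
  compositions k (suc n) ≡ concatMap (λ j → map (j ∷_) (compositions (k ∸ j) n)) (applyUpTo id (suc k))
compositions-suc zero    n = refl
compositions-suc (suc k) n = refl

sumℚ-compositions-suc : ∀ {n} (f : Seq) (h : Vec ℕ (suc n) → ℚ) (ms : Vec ℚ n) →
  (∀ j ks → h (j ∷ ks) ≡ f j * qProd ks ms) →
  ∀ k → sumℚ (map h (compositions k (suc n))) ≡ (f ⋆ λ i → qSum i ms) k
sumℚ-compositions-suc {n} f h ms h-∷ k = begin
  sumℚ (map h (compositions k (suc n)))
    ≡⟨ cong (sumℚ ∘ map h) (compositions-suc k n) ⟩
  sumℚ (map h (concatMap (λ j → map (j ∷_) (compositions (k ∸ j) n)) (applyUpTo id (suc k))))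
    ≡⟨ sumℚ-concatMap h (λ j → map (j ∷_) (compositions (k ∸ j) n)) (applyUpTo id (suc k)) ⟩
  sumℚ (map (λ j → sumℚ (map h (map (j ∷_) (compositions (k ∸ j) n)))) (applyUpTo id (suc k)))
    ≡⟨ cong sumℚ (map-applyUpTo id (λ j → sumℚ (map h (map (j ∷_) (compositions (k ∸ j) n)))) (suc k)) ⟩
  sumUpTo (suc k) (λ j → sumℚ (map h (map (j ∷_) (compositions (k ∸ j) n))))
    ≡⟨ sumUpTo-cong (suc k) splitHead ⟩
  (f ⋆ λ i → qSum i ms) k ∎
  where
  open ≡-Reasoning
  splitHead : ∀ j → sumℚ (map h (map (j ∷_) (compositions (k ∸ j) n))) ≡ f j * qSum (k ∸ j) ms
  splitHead j = begin
    sumℚ (map h (map (j ∷_) (compositions (k ∸ j) n)))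
      ≡⟨ cong sumℚ (map-∘ (compositions (k ∸ j) n)) ⟨
    sumℚ (map (λ ks → h (j ∷ ks)) (compositions (k ∸ j) n))
      ≡⟨ cong sumℚ (map-cong (h-∷ j) (compositions (k ∸ j) n)) ⟩
    sumℚ (map (λ ks → f j * qProd ks ms) (compositions (k ∸ j) n))
      ≡⟨ *-distribˡ-sumℚ (f j) (λ ks → qProd ks ms) (compositions (k ∸ j) n) ⟨
    f j * qSum (k ∸ j) ms ∎

qSum≗qSeries : ∀ {n} (ms : Vec ℚ n) → (λ k → qSum k ms) ≗ qSeries ms
qSum≗qSeries []       zero    = +-identityʳ 1ℚ
qSum≗qSeries []       (suc k) = refl
qSum≗qSeries (m ∷ ms) k =
  trans (sumℚ-compositions-suc (qSeq m) (λ ks → qProd ks (m ∷ ms)) ms (λ _ _ → refl) k)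
        (⋆-congˡ (qSeq m) (qSum≗qSeries ms) k)

qₖ≡qSeries : ∀ {n} k (ms : Vec ℚ (suc n)) → qₖ k ms ≡ qSeries ms k
qₖ≡qSeries k ms = qSum≗qSeries ms k

pₖ≡pSeq⋆qSeries : ∀ {n} k m (ms : Vec ℚ n) → pₖ k (m ∷ ms) ≡ (pSeq m ⋆ qSeries ms) k
pₖ≡pSeq⋆qSeries k m ms =
  trans (sumℚ-compositions-suc (pSeq m) _ ms (λ _ _ → refl) k)
        (⋆-congˡ (pSeq m) (qSum≗qSeries ms) k)

toℚᵘ-/ : ∀ i n .{{_ : ℕ.NonZero n}} → toℚᵘ (ℤ.+ i / n) ℚᵘ.≃ (ℤ.+ i ℚᵘ./ n)
toℚᵘ-/ i (suc n) = toℚᵘ-fromℚᵘ (ℚᵘ.mkℚᵘ (ℤ.+ i) n)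

1/-*-square : ∀ a b s .{{_ : ℕ.NonZero a}} .{{_ : ℕ.NonZero b}} → a ≡ s ℕ.* s ℕ.* b →
  (ℤ.+ 1 / a) * (ι s * ι s) ≡ ℤ.+ 1 / b
1/-*-square a@(suc _) b@(suc _) s a≡s²b = toℚᵘ-injective (let open ℚᵘ.≃-Reasoning in begin
  toℚᵘ ((ℤ.+ 1 / a) * (ι s * ι s))
    ≈⟨ ℚᵘ.≃-trans (toℚᵘ-homo-* (ℤ.+ 1 / a) (ι s * ι s)) (ℚᵘ.*-cong (toℚᵘ-/ 1 a) (toℚᵘ-homo-* (ι s) (ι s))) ⟩
  (ℤ.+ 1 ℚᵘ./ a) ℚᵘ.* (toℚᵘ (ι s) ℚᵘ.* toℚᵘ (ι s))
    ≈⟨ ℚᵘ.*-congˡ {ℤ.+ 1 ℚᵘ./ a} (ℚᵘ.*-cong (toℚᵘ-/ s 1) (toℚᵘ-/ s 1)) ⟩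
  (ℤ.+ 1 ℚᵘ./ a) ℚᵘ.* ((ℤ.+ s ℚᵘ./ 1) ℚᵘ.* (ℤ.+ s ℚᵘ./ 1))
    ≈⟨ ℚᵘ.*≡* cross-multiplied ⟩
  ℤ.+ 1 ℚᵘ./ b
    ≈⟨ toℚᵘ-/ 1 b ⟨
  toℚᵘ (ℤ.+ 1 / b) ∎)
  where
  cross-multiplied : (ℤ.+ 1 ℤ.* (ℤ.+ s ℤ.* ℤ.+ s)) ℤ.* ℤ.+ b ≡ ℤ.+ 1 ℤ.* ℤ.+ (a ℕ.* 1)
  cross-multiplied = begin
    (ℤ.+ 1 ℤ.* (ℤ.+ s ℤ.* ℤ.+ s)) ℤ.* ℤ.+ b
      ≡⟨ cong (λ z → (ℤ.+ 1 ℤ.* z) ℤ.* ℤ.+ b) (ℤ.pos-* s s) ⟨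
    (ℤ.+ 1 ℤ.* ℤ.+ (s ℕ.* s)) ℤ.* ℤ.+ b
      ≡⟨ cong (ℤ._* ℤ.+ b) (ℤ.*-identityˡ (ℤ.+ (s ℕ.* s))) ⟩
    ℤ.+ (s ℕ.* s) ℤ.* ℤ.+ b
      ≡⟨ ℤ.pos-* (s ℕ.* s) b ⟨
    ℤ.+ (s ℕ.* s ℕ.* b)
      ≡⟨ cong ℤ.+_ (trans (sym a≡s²b) (sym (ℕ.*-identityʳ a))) ⟩
    ℤ.+ (a ℕ.* 1)
      ≡⟨ ℤ.*-identityˡ (ℤ.+ (a ℕ.* 1)) ⟨
    ℤ.+ 1 ℤ.* ℤ.+ (a ℕ.* 1) ∎
    where open ≡-Reasoning

invFact²-suc : ∀ j → invFact² (suc j) * (ι (suc j) * ι (suc j)) ≡ invFact² j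
invFact²-suc j = 1/-*-square (suc j ! ℕ.* suc j !) (j ! ℕ.* j !) (suc j) {{suc j !* suc j !≢0}} {{j !* j !≢0}}
  (square-* (suc j) (j !))
  where
  square-* : ∀ s F → (s ℕ.* F) ℕ.* (s ℕ.* F) ≡ s ℕ.* s ℕ.* (F ℕ.* F)
  square-* = solve-∀

-- The i = 0 factor m² of q_{j+1}(m) is split as (m² - (j+1)²) + (j+1)².
q₁-suc : ∀ j m → q₁ (suc j) m ≡ p₁ (suc j) m + p₁ j m
q₁-suc j m = begin
  c * ((m * m - ι 0 * ι 0) * prodℚ (map (λ i → m * m - ι i * ι i) (applyUpTo suc j)))
    ≡⟨ cong (λ xs → c * ((m * m - 0ℚ) * prodℚ xs)) (map-applyUpTo suc (λ i → m * m - ι i * ι i) j) ⟩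
  c * ((m * m - 0ℚ) * Π)
    ≡⟨ split-m² c m Π (ι (suc j)) ⟩
  c * (Π * (m * m - ι (suc j) * ι (suc j))) + (c * (ι (suc j) * ι (suc j))) * Π
    ≡⟨ cong₂ (λ u v → c * u + v * Π) (sym (prodℚ-applyUpTo-suc j g)) (invFact²-suc j) ⟩
  p₁ (suc j) m + p₁ j m ∎
  where
  open ≡-Reasoning
  c = invFact² (suc j)
  g : ℕ → ℚ
  g i = m * m - ι (suc i) * ι (suc i)
  Π = prodℚ (applyUpTo g j)
  split-m² : ∀ c m Π x → c * ((m * m - 0ℚ) * Π) ≡ c * (Π * (m * m - x * x)) + (c * (x * x)) * Π
  split-m² = +-*-Solver.solve 4 (λ c m Π x →
    c :* ((m :* m :- con 0ℚ) :* Π) := c :* (Π :* (m :* m :- x :* x)) :+ (c :* (x :* x)) :* Π) refl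
    where open +-*-Solver

qSeq-0 : qSeq 0ℚ ≗ δ
qSeq-0 zero    = refl
qSeq-0 (suc j) = trans (cong (invFact² (suc j) *_) (*-zeroˡ (prodℚ (map (λ i → 0ℚ * 0ℚ - ι i * ι i) (applyUpTo suc j)))))
  (*-zeroʳ (invFact² (suc j)))

qSeries-∷ʳ-0 : ∀ {n} (ms : Vec ℚ n) → qSeries (ms ∷ʳ 0ℚ) ≗ qSeries ms
qSeries-∷ʳ-0 []       k = trans (⋆-identityʳ (qSeq 0ℚ) k) (qSeq-0 k)
qSeries-∷ʳ-0 (m ∷ ms) k = ⋆-congˡ (qSeq m) (qSeries-∷ʳ-0 ms) k

qSeries-permute : ∀ {n} (ms : Vec ℚ n) (σ : Permutation′ n) →
  qSeries (tabulate (λ i → lookup ms (σ ⟨$⟩ʳ i))) ≗ qSeries ms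
qSeries-permute ms σ k = begin
  qSeries (tabulate (λ i → lookup ms (σ ⟨$⟩ʳ i))) k
    ≡⟨ cong-app (sum-cong-≗ (λ i → cong qSeq (lookup∘tabulate (λ i → lookup ms (σ ⟨$⟩ʳ i)) i))) k ⟩
  sum (λ i → qSeq (lookup ms (σ ⟨$⟩ʳ i))) k
    ≡⟨ sum-permute (λ i → qSeq (lookup ms i)) σ k ⟨
  qSeries ms k ∎
  where open ≡-Reasoning

pₖ-0≡qₖ-0 : ∀ {n} (ms : Vec ℚ (suc n)) → pₖ 0 ms ≡ qₖ 0 ms
pₖ-0≡qₖ-0 (m ∷ ms) = trans (pₖ≡pSeq⋆qSeries 0 m ms) (sym (qₖ≡qSeries 0 (m ∷ ms)))

pₖ-suc-+-pₖ : ∀ {n} k (ms : Vec ℚ (suc n)) → pₖ (suc k) ms + pₖ k ms ≡ qₖ (suc k) ms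
pₖ-suc-+-pₖ k (m ∷ ms) = begin
  pₖ (suc k) (m ∷ ms) + pₖ k (m ∷ ms)
    ≡⟨ cong₂ _+_ (pₖ≡pSeq⋆qSeries (suc k) m ms) (pₖ≡pSeq⋆qSeries k m ms) ⟩
  (pSeq m ⋆ qSeries ms) (suc k) + (pSeq m ⋆ qSeries ms) k
    ≡⟨ ⋆-1+x (pSeq m) (qSeq m) (qSeries ms) refl (λ j → q₁-suc j m) k ⟨
  (qSeq m ⋆ qSeries ms) (suc k)
    ≡⟨ qₖ≡qSeries (suc k) (m ∷ ms) ⟨
  qₖ (suc k) (m ∷ ms) ∎
  where open ≡-Reasoning

pₖ-determined-by-qₖ : ∀ {n} (ms ms′ : Vec ℚ (suc n)) →
  (∀ k → qₖ k ms ≡ qₖ k ms′) → ∀ k → pₖ k ms ≡ pₖ k ms′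
pₖ-determined-by-qₖ ms ms′ eq zero =
  trans (pₖ-0≡qₖ-0 ms) (trans (eq 0) (sym (pₖ-0≡qₖ-0 ms′)))
pₖ-determined-by-qₖ ms ms′ eq (suc k) = ∙-cancelʳ (pₖ k ms) (pₖ (suc k) ms) (pₖ (suc k) ms′) (begin
  pₖ (suc k) ms + pₖ k ms   ≡⟨ pₖ-suc-+-pₖ k ms ⟩
  qₖ (suc k) ms             ≡⟨ eq (suc k) ⟩
  qₖ (suc k) ms′            ≡⟨ pₖ-suc-+-pₖ k ms′ ⟨
  pₖ (suc k) ms′ + pₖ k ms′ ≡⟨ cong (pₖ (suc k) ms′ +_) (pₖ-determined-by-qₖ ms ms′ eq k) ⟨
  pₖ (suc k) ms′ + pₖ k ms  ∎)
  where open ≡-Reasoning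

qₖ-permute : ∀ {n} k (ms : Vec ℚ (suc n)) (σ : Permutation′ (suc n)) →
  qₖ k (tabulate (λ i → lookup ms (σ ⟨$⟩ʳ i))) ≡ qₖ k ms
qₖ-permute k ms σ = begin
  qₖ k (tabulate (λ i → lookup ms (σ ⟨$⟩ʳ i))) ≡⟨ qₖ≡qSeries k _ ⟩
  qSeries (tabulate (λ i → lookup ms (σ ⟨$⟩ʳ i))) k ≡⟨ qSeries-permute ms σ k ⟩
  qSeries ms k ≡⟨ qₖ≡qSeries k ms ⟨
  qₖ k ms ∎
  where open ≡-Reasoning

qₖ-∷ʳ-0 : ∀ {n} k (ms : Vec ℚ (suc n)) → qₖ k (ms ∷ʳ 0ℚ) ≡ qₖ k ms
qₖ-∷ʳ-0 k ms =
  trans (qₖ≡qSeries k (ms ∷ʳ 0ℚ)) (trans (qSeries-∷ʳ-0 ms k) (sym (qₖ≡qSeries k ms)))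

pₖ-∷ʳ-0 : ∀ {n} k (ms : Vec ℚ (suc n)) → pₖ k (ms ∷ʳ 0ℚ) ≡ pₖ k ms
pₖ-∷ʳ-0 k (m ∷ ms) = begin
  pₖ k ((m ∷ ms) ∷ʳ 0ℚ)           ≡⟨ pₖ≡pSeq⋆qSeries k m (ms ∷ʳ 0ℚ) ⟩
  (pSeq m ⋆ qSeries (ms ∷ʳ 0ℚ)) k ≡⟨ ⋆-congˡ (pSeq m) (qSeries-∷ʳ-0 ms) k ⟩
  (pSeq m ⋆ qSeries ms) k         ≡⟨ pₖ≡pSeq⋆qSeries k m ms ⟨
  pₖ k (m ∷ ms)                   ∎
  where open ≡-Reasoning

proposition1 : (k n : ℕ) →
    ((m : Vec ℚ (suc n)) (σ : Permutation′ (suc n)) →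
       pₖ k (tabulate (λ i → lookup m (σ ⟨$⟩ʳ i))) ≡ pₖ k m)
    × ((m : Vec ℚ (suc n)) (σ : Permutation′ (suc n)) →
       qₖ k (tabulate (λ i → lookup m (σ ⟨$⟩ʳ i))) ≡ qₖ k m)
    × ((m : Vec ℚ (suc n)) → pₖ k (m ∷ʳ 0ℚ) ≡ pₖ k m)
    × ((m : Vec ℚ (suc n)) → qₖ k (m ∷ʳ 0ℚ) ≡ qₖ k m)
proposition1 k n =
    (λ ms σ → pₖ-determined-by-qₖ _ ms (λ k′ → qₖ-permute k′ ms σ) k)
  , qₖ-permute k
  , pₖ-∷ʳ-0 k
  , qₖ-∷ʳ-0 k
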